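{- Let $\alpha,\beta,\gamma$ be three planes of $\mathrm{PG}(8,q)$ which together span $\mathrm{PG}(8,q)$. Let $P$ be a point of $\mathrm{PG}(8,q)$ which does not lie on any line that meets two of the planes $\alpha,\beta,\gamma$. Then $P$ lies on a unique plane of $\mathrm{PG}(8,q)$ that meets each of $\alpha,\beta,\gamma$.
   Context: $q$ is a prime power and $\mathrm{PG}(8,q)$ is the $8$-dimensional projective space over the finite field $\mathbb F_q$. -}

module Defs where

open import Level using (Level; _⊔_)
open import Algebra.Bundles using (CommutativeRing)
open import Data.Nat using (ℕ; zero; suc)
open import Data.Fin using (Fin; zero; suc)
open import Data.Product using (Σ; ∃; _×_; _,_)
open import Data.Sum using (_⊎_)
open import Relation.Nullary using (¬_)
open import Function.Bundles using (_⇔_)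
open import Relation.Binary.PropositionalEquality using (_≡_)

record Field (c ℓ : Level) : Set (Level.suc (c ⊔ ℓ)) where
  field
    commRing : CommutativeRing c ℓ
  open CommutativeRing commRing public
  field
    0≉1     : ¬ (0# ≈ 1#)
    inverse : ∀ x → ¬ (x ≈ 0#) → ∃ λ y → x * y ≈ 1#

record FiniteField (c ℓ : Level) (q : ℕ) : Set (Level.suc (c ⊔ ℓ)) where
  field
    fld : Field c ℓ
  open Field fld public
  field
    enum       : Fin q → Carrier
    enum-inj   : ∀ i j → enum i ≈ enum j → i ≡ j
    enum-surj  : ∀ x → ∃ λ i → enum i ≈ x

-- Linear algebra in F^n, vectors as functions Fin n → Carrier.
-- Projective subspaces of PG(n-1,F) are represented by spanning families
-- of linearly independent vectors of F^n.
module Geometry {c ℓ : Level} (F : Field c ℓ) where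
  open Field F hiding (zero)

  Vect : ℕ → Set c
  Vect n = Fin n → Carrier

  ∑ : ∀ {m} → (Fin m → Carrier) → Carrier
  ∑ {zero}  f = 0#
  ∑ {suc m} f = f zero + ∑ (λ i → f (suc i))

  lincomb : ∀ {m n} → (Fin m → Vect n) → (Fin m → Carrier) → Vect n
  lincomb v a j = ∑ (λ i → a i * v i j)

  _≈ᵥ_ : ∀ {n} → Vect n → Vect n → Set ℓ
  x ≈ᵥ y = ∀ j → x j ≈ y j

  IsZero : ∀ {n} → Vect n → Set ℓ
  IsZero x = ∀ j → x j ≈ 0#

  NonZero : ∀ {n} → Vect n → Set ℓ
  NonZero x = ¬ IsZero x

  LinIndep : ∀ {m n} → (Fin m → Vect n) → Set (c ⊔ ℓ)
  LinIndep v = ∀ a → IsZero (lincomb v a) → ∀ i → a i ≈ 0#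

  InSpan : ∀ {m n} → (Fin m → Vect n) → Vect n → Set (c ⊔ ℓ)
  InSpan v x = ∃ λ a → x ≈ᵥ lincomb v a

  Spans : ∀ {m n} → (Fin m → Vect n) → Set (c ⊔ ℓ)
  Spans {n = n} v = ∀ (x : Vect n) → InSpan v x

  Meets : ∀ {m k n} → (Fin m → Vect n) → (Fin k → Vect n) → Set (c ⊔ ℓ)
  Meets v w = ∃ λ x → NonZero x × InSpan v x × InSpan w x

  SameSpan : ∀ {m k n} → (Fin m → Vect n) → (Fin k → Vect n) → Set (c ⊔ ℓ)
  SameSpan v w = ∀ x → (InSpan v x → InSpan w x) × (InSpan w x → InSpan v x)

  join3 : ∀ {n} → (Fin 3 → Vect n) → (Fin 3 → Vect n) → (Fin 3 → Vect n) → Fin 9 → Vect n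
  join3 a b d zero = a zero
  join3 a b d (suc zero) = a (suc zero)
  join3 a b d (suc (suc zero)) = a (suc (suc zero))
  join3 a b d (suc (suc (suc i))) = join3' b d i
    where
    join3' : ∀ {n} → (Fin 3 → Vect n) → (Fin 3 → Vect n) → Fin 6 → Vect n
    join3' b d zero = b zero
    join3' b d (suc zero) = b (suc zero)
    join3' b d (suc (suc zero)) = b (suc (suc zero))
    join3' b d (suc (suc (suc i))) = d i

  -- In PG(8,F): a point is spanned by a nonzero vector of F^9, a line by
  -- 2 independent vectors, a plane by 3 independent vectors.
  Line : Set c
  Line = Fin 2 → Vect 9

  Plane : Set c
  Plane = Fin 3 → Vect 9

-- Write P = a + b + c with a, b, c in the subspaces α, β, γ, which are independent since their
-- 9 spanning vectors span F⁹. No summand vanishes, for otherwise P would lie on a line joining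
-- points of the other two planes; so ⟨a, b, c⟩ is a plane through P meeting all three. Conversely, a plane π′ through P meeting α, β, γ in x, y, z is spanned by these
-- three independent points, and comparing P = μx + νy + ρz with the (unique) decomposition
-- P = a + b + c shows a = μx, b = νy, c = ρz, so ⟨a, b, c⟩ ⊆ π′ and the two planes coincide.
module Submission where

open import Defs
open import Level using (_⊔_)
open import Data.Nat.Base as ℕ using (ℕ; zero; suc)
open import Data.Fin.Base using (Fin; zero; suc; punchIn; punchOut; _↑ˡ_; _↑ʳ_)
open import Data.Fin.Patterns using (0F; 1F; 2F)
open import Data.Fin.Properties using (all?; ¬∀⟶∃¬; punchIn-punchOut) renaming (_≟_ to _≟ᶠ_)
open import Data.Vec.Functional using (_∷_; []; _++_; removeAt)
open import Data.Vec.Functional.Properties using (lookup-++ˡ; lookup-++ʳ)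
open import Data.Product using (Σ; ∃; ∃₂; _×_; _,_; proj₁; proj₂)
open import Data.Sum using (_⊎_; inj₁; inj₂)
open import Function.Base using (_∘_)
open import Relation.Binary.Definitions using (Decidable)
open import Relation.Nullary using (¬_; Dec; yes; no; contradiction)
import Relation.Nullary.Decidable as Dec
open import Relation.Binary.PropositionalEquality as ≡ using (_≡_)

module _ {c ℓ q} (K : FiniteField c ℓ q) where
  open FiniteField K

  ≈-decidable : Decidable _≈_
  ≈-decidable x y with enum-surj x | enum-surj y
  ... | i , eᵢ≈x | j , eⱼ≈y =
    Dec.map′ (λ i≡j → trans (sym eᵢ≈x) (trans (reflexive (≡.cong enum i≡j)) eⱼ≈y))
             (λ x≈y → enum-inj i j (trans eᵢ≈x (trans x≈y (sym eⱼ≈y))))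
             (i ≟ᶠ j)

module LinearAlgebra {c ℓ} (F : Field c ℓ) (_≈?_ : Decidable (Field._≈_ F)) where
  open Field F hiding (zero)
  open Geometry F
  open import Algebra.Properties.Ring ring using (-‿distribˡ-*; -‿distribʳ-*; -1*x≈-x; +-inverseˡ-unique)
  open import Algebra.Properties.Semiring.Sum semiring as Sum using (sum)
  open import Relation.Binary.Reasoning.Setoid setoid

  infixr 6 _+ᵥ_
  infixr 7 _*ᵥ_

  _+ᵥ_ : ∀ {n} → Vect n → Vect n → Vect n
  (x +ᵥ y) j = x j + y j

  _*ᵥ_ : ∀ {n} → Carrier → Vect n → Vect n
  (a *ᵥ x) j = a * x j

  0ᵥ : ∀ {n} → Vect n
  0ᵥ _ = 0#

  IsZero? : ∀ {n} (x : Vect n) → Dec (IsZero x)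
  IsZero? x = all? (λ j → x j ≈? 0#)

  x*y≈0⇒y≈0 : ∀ {x y} → ¬ x ≈ 0# → x * y ≈ 0# → y ≈ 0#
  x*y≈0⇒y≈0 {x} {y} x≉0 xy≈0 with inverse x x≉0
  ... | x⁻¹ , xx⁻¹≈1 = begin
    y              ≈⟨ *-identityˡ y ⟨
    1# * y         ≈⟨ *-congʳ (trans (sym xx⁻¹≈1) (*-comm x x⁻¹)) ⟩
    (x⁻¹ * x) * y  ≈⟨ *-assoc x⁻¹ x y ⟩
    x⁻¹ * (x * y)  ≈⟨ *-congˡ xy≈0 ⟩
    x⁻¹ * 0#       ≈⟨ zeroʳ x⁻¹ ⟩
    0#             ∎

  *ᵥ-IsZero⇒≈0 : ∀ {n a} {x : Vect n} → NonZero x → IsZero (a *ᵥ x) → a ≈ 0#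
  *ᵥ-IsZero⇒≈0 {a = a} x≉0 ax≈0 with a ≈? 0#
  ... | yes a≈0 = a≈0
  ... | no  a≉0 = contradiction (λ j → x*y≈0⇒y≈0 a≉0 (ax≈0 j)) x≉0

  x+-[x*p⁻¹]*p≈0 : ∀ x {p p⁻¹} → p * p⁻¹ ≈ 1# → x + (- (x * p⁻¹)) * p ≈ 0#
  x+-[x*p⁻¹]*p≈0 x {p} {p⁻¹} pp⁻¹≈1 = begin
    x + (- (x * p⁻¹)) * p  ≈⟨ +-congˡ (-‿distribˡ-* (x * p⁻¹) p) ⟨
    x + - ((x * p⁻¹) * p)  ≈⟨ +-congˡ (-‿cong (*-assoc x p⁻¹ p)) ⟩
    x + - (x * (p⁻¹ * p))  ≈⟨ +-congˡ (-‿cong (*-congˡ (trans (*-comm p⁻¹ p) pp⁻¹≈1))) ⟩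
    x + - (x * 1#)         ≈⟨ +-congˡ (-‿cong (*-identityʳ x)) ⟩
    x + - x                ≈⟨ -‿inverseʳ x ⟩
    0#                     ∎

  a*x+y≈0⇒x≈-b*y : ∀ {a b x y} → a * x + y ≈ 0# → a * b ≈ 1# → x ≈ (- b) * y
  a*x+y≈0⇒x≈-b*y {a} {b} {x} {y} ax+y≈0 ab≈1 = begin
    x            ≈⟨ *-identityˡ x ⟨
    1# * x       ≈⟨ *-congʳ (trans (sym ab≈1) (*-comm a b)) ⟩
    (b * a) * x  ≈⟨ *-assoc b a x ⟩
    b * (a * x)  ≈⟨ *-congˡ (+-inverseˡ-unique (a * x) y ax+y≈0) ⟩
    b * (- y)    ≈⟨ -‿distribʳ-* b y ⟨
    - (b * y)    ≈⟨ -‿distribˡ-* b y ⟩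
    (- b) * y    ∎

  ∑≈sum : ∀ {m} (f : Fin m → Carrier) → ∑ f ≈ sum f
  ∑≈sum {zero}  f = refl
  ∑≈sum {suc m} f = +-congˡ (∑≈sum (f ∘ suc))

  ∑-cong : ∀ {m} {f g : Fin m → Carrier} → (∀ i → f i ≈ g i) → ∑ f ≈ ∑ g
  ∑-cong {f = f} {g} f≈g = trans (∑≈sum f) (trans (Sum.sum-cong-≋ f≈g) (sym (∑≈sum g)))

  ∑-zero : ∀ {m} {f : Fin m → Carrier} → (∀ i → f i ≈ 0#) → ∑ f ≈ 0#
  ∑-zero {m} f≈0 = trans (∑-cong f≈0) (trans (∑≈sum {m} (λ _ → 0#)) (Sum.sum-replicate-zero m))

  ∑-distrib-+ : ∀ {m} (f g : Fin m → Carrier) → ∑ (λ i → f i + g i) ≈ ∑ f + ∑ g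
  ∑-distrib-+ f g =
    trans (∑≈sum (λ i → f i + g i)) (trans (Sum.∑-distrib-+ f g) (sym (+-cong (∑≈sum f) (∑≈sum g))))

  *-distribˡ-∑ : ∀ {m} x (f : Fin m → Carrier) → x * ∑ f ≈ ∑ (λ i → x * f i)
  *-distribˡ-∑ x f = trans (*-congˡ (∑≈sum f)) (trans (Sum.*-distribˡ-sum x f) (sym (∑≈sum (λ i → x * f i))))

  *-distribʳ-∑ : ∀ {m} x (f : Fin m → Carrier) → ∑ f * x ≈ ∑ (λ i → f i * x)
  *-distribʳ-∑ x f = trans (*-congʳ (∑≈sum f)) (trans (Sum.*-distribʳ-sum x f) (sym (∑≈sum (λ i → f i * x))))

  ∑-comm : ∀ {m n} (f : Fin m → Fin n → Carrier) → ∑ (λ i → ∑ (f i)) ≈ ∑ (λ j → ∑ (λ i → f i j))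
  ∑-comm f = begin
    ∑ (λ i → ∑ (f i))              ≈⟨ ∑-cong (λ i → ∑≈sum (f i)) ⟩
    ∑ (λ i → sum (f i))            ≈⟨ ∑≈sum (λ i → sum (f i)) ⟩
    sum (λ i → sum (f i))          ≈⟨ Sum.∑-comm f ⟩
    sum (λ j → sum (λ i → f i j))  ≈⟨ ∑≈sum (λ j → sum (λ i → f i j)) ⟨
    ∑ (λ j → sum (λ i → f i j))    ≈⟨ ∑-cong (λ j → ∑≈sum (λ i → f i j)) ⟨
    ∑ (λ j → ∑ (λ i → f i j))      ∎

  ∑-remove : ∀ {m} (i : Fin (suc m)) (f : Fin (suc m) → Carrier) → ∑ f ≈ f i + ∑ (removeAt f i)
  ∑-remove i f = trans (∑≈sum f) (trans (Sum.sum-remove f) (+-congˡ (sym (∑≈sum (removeAt f i)))))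

  ∑-split : ∀ {k l} (f : Fin (k ℕ.+ l) → Carrier) → ∑ f ≈ ∑ (f ∘ (_↑ˡ l)) + ∑ (f ∘ (k ↑ʳ_))
  ∑-split {zero}      f = sym (+-identityˡ (∑ f))
  ∑-split {suc k} {l} f = trans (+-congˡ (∑-split {k} {l} (f ∘ suc))) (sym (+-assoc _ _ _))

  lincomb-cong : ∀ {m n} (v : Fin m → Vect n) {a b : Fin m → Carrier} → (∀ i → a i ≈ b i) →
                 lincomb v a ≈ᵥ lincomb v b
  lincomb-cong v a≈b j = ∑-cong (λ i → *-congʳ (a≈b i))

  lincomb-zero : ∀ {m n} (v : Fin m → Vect n) {a : Fin m → Carrier} → IsZero a → IsZero (lincomb v a)
  lincomb-zero v a≈0 j = ∑-zero (λ i → trans (*-congʳ (a≈0 i)) (zeroˡ _))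

  lincomb-vanishing : ∀ {m n} (v : Fin m → Vect n) (a : Fin m → Carrier) j → (∀ i → v i j ≈ 0#) →
                      lincomb v a j ≈ 0#
  lincomb-vanishing v a j vᵢⱼ≈0 = ∑-zero (λ i → trans (*-congˡ (vᵢⱼ≈0 i)) (zeroʳ (a i)))

  lincomb-* : ∀ {m n} (v : Fin m → Vect n) k (a : Fin m → Carrier) →
              lincomb v (λ i → k * a i) ≈ᵥ (k *ᵥ lincomb v a)
  lincomb-* v k a j = trans (∑-cong (λ i → *-assoc k (a i) (v i j))) (sym (*-distribˡ-∑ k (λ i → a i * v i j)))

  lincomb-+ : ∀ {m n} (v : Fin m → Vect n) (a b : Fin m → Carrier) →
              lincomb v (λ i → a i + b i) ≈ᵥ (lincomb v a +ᵥ lincomb v b)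
  lincomb-+ v a b j =
    trans (∑-cong (λ i → distribʳ (v i j) (a i) (b i))) (∑-distrib-+ (λ i → a i * v i j) (λ i → b i * v i j))

  lincomb-∘ : ∀ {k m n} (u : Fin k → Vect n) (v : Fin m → Vect n) (C : Fin m → Vect k) →
              (∀ i → v i ≈ᵥ lincomb u (C i)) → ∀ a → lincomb v a ≈ᵥ lincomb u (lincomb C a)
  lincomb-∘ u v C v≈uC a j = begin
    ∑ (λ i → a i * v i j)
      ≈⟨ ∑-cong (λ i → *-congˡ (v≈uC i j)) ⟩
    ∑ (λ i → a i * ∑ (λ k → C i k * u k j))
      ≈⟨ ∑-cong (λ i → *-distribˡ-∑ (a i) (λ k → C i k * u k j)) ⟩
    ∑ (λ i → ∑ (λ k → a i * (C i k * u k j)))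
      ≈⟨ ∑-cong (λ i → ∑-cong (λ k → sym (*-assoc (a i) (C i k) (u k j)))) ⟩
    ∑ (λ i → ∑ (λ k → (a i * C i k) * u k j))
      ≈⟨ ∑-comm (λ i k → (a i * C i k) * u k j) ⟩
    ∑ (λ k → ∑ (λ i → (a i * C i k) * u k j))
      ≈⟨ ∑-cong (λ k → *-distribʳ-∑ (u k j) (λ i → a i * C i k)) ⟨
    ∑ (λ k → ∑ (λ i → a i * C i k) * u k j)
      ∎

  lincomb-removeAt : ∀ {m n} (v : Fin (suc m) → Vect n) (a : Fin (suc m) → Carrier) i →
                     lincomb v a ≈ᵥ (a i *ᵥ v i +ᵥ lincomb (removeAt v i) (removeAt a i))
  lincomb-removeAt v a i j = ∑-remove i (λ r → a r * v r j)

  lincomb-++ : ∀ {k l n} (X : Fin k → Vect n) (Y : Fin l → Vect n) g →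
               lincomb (X ++ Y) g ≈ᵥ (lincomb X (g ∘ (_↑ˡ l)) +ᵥ lincomb Y (g ∘ (k ↑ʳ_)))
  lincomb-++ {k} {l} X Y g j = trans (∑-split {k} {l} (λ i → g i * (X ++ Y) i j))
    (+-cong (∑-cong (λ i → *-congˡ (reflexive (≡.cong (λ x → x j) (lookup-++ˡ X Y i)))))
            (∑-cong (λ i → *-congˡ (reflexive (≡.cong (λ x → x j) (lookup-++ʳ X Y i))))))

  lincomb-++-++ : ∀ {k l n} (X : Fin k → Vect n) (Y : Fin l → Vect n) s t →
                  lincomb (X ++ Y) (s ++ t) ≈ᵥ (lincomb X s +ᵥ lincomb Y t)
  lincomb-++-++ X Y s t j = trans (lincomb-++ X Y (s ++ t) j)
    (+-cong (lincomb-cong X (λ i → reflexive (lookup-++ˡ s t i)) j)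
            (lincomb-cong Y (λ i → reflexive (lookup-++ʳ s t i)) j))

  IsZero-++ : ∀ {k l} (s : Vect k) (t : Vect l) → IsZero (s ++ t) → IsZero s × IsZero t
  IsZero-++ {k} {l} s t s++t≈0 = (λ i → trans (reflexive (≡.sym (lookup-++ˡ s t i))) (s++t≈0 (i ↑ˡ l)))
                               , (λ i → trans (reflexive (≡.sym (lookup-++ʳ s t i))) (s++t≈0 (k ↑ʳ i)))

  δ : ∀ {n} → Fin n → Vect n
  δ zero    zero    = 1#
  δ zero    (suc _) = 0#
  δ (suc _) zero    = 0#
  δ (suc i) (suc j) = δ i j

  δ-sym : ∀ {n} (i j : Fin n) → δ i j ≡ δ j i
  δ-sym zero    zero    = ≡.refl
  δ-sym zero    (suc _) = ≡.refl
  δ-sym (suc _) zero    = ≡.refl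
  δ-sym (suc i) (suc j) = δ-sym i j

  δ-diag : ∀ {n} (i : Fin n) → δ i i ≡ 1#
  δ-diag zero    = ≡.refl
  δ-diag (suc i) = δ-diag i

  ∑-δ : ∀ {n} (i : Fin n) (f : Fin n → Carrier) → ∑ (λ r → δ i r * f r) ≈ f i
  ∑-δ zero f = begin
    1# * f zero + ∑ (λ r → 0# * f (suc r))  ≈⟨ +-cong (*-identityˡ (f zero)) (∑-zero (λ r → zeroˡ (f (suc r)))) ⟩
    f zero + 0#                             ≈⟨ +-identityʳ (f zero) ⟩
    f zero                                  ∎
  ∑-δ (suc i) f = begin
    0# * f zero + ∑ (λ r → δ i r * f (suc r))  ≈⟨ +-cong (zeroˡ (f zero)) (∑-δ i (f ∘ suc)) ⟩
    0# + f (suc i)                             ≈⟨ +-identityˡ (f (suc i)) ⟩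
    f (suc i)                                  ∎

  lincomb-δ : ∀ {n} (a : Vect n) → lincomb δ a ≈ᵥ a
  lincomb-δ a j = trans (∑-cong (λ r → trans (*-comm (a r) (δ r j)) (*-congʳ (reflexive (δ-sym r j))))) (∑-δ j a)

  LinIndep-δ : ∀ {n} → LinIndep (δ {n})
  LinIndep-δ a δa≈0 i = trans (sym (lincomb-δ a i)) (δa≈0 i)

  InSpan-member : ∀ {m n} (v : Fin m → Vect n) i → InSpan v (v i)
  InSpan-member v i = δ i , λ j → sym (∑-δ i (λ r → v r j))

  LinIndep⇒NonZero : ∀ {m n} {v : Fin m → Vect n} → LinIndep v → ∀ i → NonZero (v i)
  LinIndep⇒NonZero {v = v} v-indep i vᵢ≈0 = 0≉1 (sym (trans (reflexive (≡.sym (δ-diag i))) δᵢᵢ≈0))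
    where
    δᵢᵢ≈0 : δ i i ≈ 0#
    δᵢᵢ≈0 = v-indep (δ i) (λ j → trans (sym (proj₂ (InSpan-member v i) j)) (vᵢ≈0 j)) i

  InSpan-resp : ∀ {m n} {v : Fin m → Vect n} {x y} → x ≈ᵥ y → InSpan v x → InSpan v y
  InSpan-resp x≈y (a , x≈va) = a , λ j → trans (sym (x≈y j)) (x≈va j)

  InSpan-0 : ∀ {m n} {v : Fin m → Vect n} → InSpan v 0ᵥ
  InSpan-0 {v = v} = (λ _ → 0#) , λ j → sym (lincomb-zero v (λ _ → refl) j)

  InSpan-+ : ∀ {m n} {v : Fin m → Vect n} {x y} → InSpan v x → InSpan v y → InSpan v (x +ᵥ y)
  InSpan-+ {v = v} (a , x≈va) (b , y≈vb) =
    (λ i → a i + b i) , λ j → trans (+-cong (x≈va j) (y≈vb j)) (sym (lincomb-+ v a b j))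

  InSpan-* : ∀ {m n} {v : Fin m → Vect n} {x} k → InSpan v x → InSpan v (k *ᵥ x)
  InSpan-* {v = v} k (a , x≈va) = (λ i → k * a i) , λ j → trans (*-congˡ (x≈va j)) (sym (lincomb-* v k a j))

  InSpan-trans : ∀ {k m n} {u : Fin k → Vect n} {v : Fin m → Vect n} → (∀ i → InSpan u (v i)) →
                 ∀ {x} → InSpan v x → InSpan u x
  InSpan-trans {u = u} {v} v⊆u (a , x≈va) = lincomb C a , λ j → trans (x≈va j) (lincomb-∘ u v C (proj₂ ∘ v⊆u) a j)
    where
    C : _ → Vect _
    C = proj₁ ∘ v⊆u

  InSpan-++ : ∀ {k l n} {X : Fin k → Vect n} {Y : Fin l → Vect n} {x} → InSpan (X ++ Y) x →
              ∃₂ λ u v → InSpan X u × InSpan Y v × x ≈ᵥ (u +ᵥ v)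
  InSpan-++ {k} {l} {X = X} {Y} (g , x≈g) = lincomb X (g ∘ (_↑ˡ l)) , lincomb Y (g ∘ (k ↑ʳ_)) ,
    (_ , λ _ → refl) , (_ , λ _ → refl) , λ j → trans (x≈g j) (lincomb-++ X Y g j)

  InSpan-++₃ : ∀ {k l m n} {X : Fin k → Vect n} {Y : Fin l → Vect n} {Z : Fin m → Vect n} {x} →
               InSpan (X ++ (Y ++ Z)) x →
               ∃₂ λ u v → ∃ λ w → InSpan X u × InSpan Y v × InSpan Z w × x ≈ᵥ (u +ᵥ (v +ᵥ w))
  InSpan-++₃ {X = X} {Y} {Z} x∈XYZ with InSpan-++ {X = X} {Y = Y ++ Z} x∈XYZ
  ... | u , vw , u∈X , vw∈YZ , x≈u+vw with InSpan-++ {X = Y} {Y = Z} vw∈YZ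
  ...   | v , w , v∈Y , w∈Z , vw≈v+w =
    u , v , w , u∈X , v∈Y , w∈Z , λ j → trans (x≈u+vw j) (+-congˡ (vw≈v+w j))

  Dependent : ∀ {m n} → (Fin m → Vect n) → Set (c ⊔ ℓ)
  Dependent v = ∃ λ a → NonZero a × IsZero (lincomb v a)

  Dependent-head-zero : ∀ {m n} (v : Fin (suc m) → Vect n) → IsZero (v zero) → Dependent v
  Dependent-head-zero v v₀≈0 = (1# ∷ λ _ → 0#) , (λ a≈0 → 0≉1 (sym (a≈0 zero))) , λ j → begin
    1# * v zero j + ∑ (λ i → 0# * v (suc i) j)
      ≈⟨ +-cong (trans (*-identityˡ (v zero j)) (v₀≈0 j)) (∑-zero (λ i → zeroˡ (v (suc i) j))) ⟩
    0# + 0#  ≈⟨ +-identityˡ 0# ⟩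
    0#       ∎

  lincomb-rowOp : ∀ {m n} (v : Fin (suc m) → Vect n) (t b : Fin m → Carrier) →
                  lincomb (λ i → v (suc i) +ᵥ t i *ᵥ v zero) b ≈ᵥ lincomb v (∑ (λ i → b i * t i) ∷ b)
  lincomb-rowOp v t b j = begin
    ∑ (λ i → b i * (v (suc i) j + t i * v zero j))
      ≈⟨ ∑-cong (λ i → trans (distribˡ (b i) _ _) (+-congˡ (sym (*-assoc (b i) (t i) _)))) ⟩
    ∑ (λ i → b i * v (suc i) j + (b i * t i) * v zero j)
      ≈⟨ ∑-distrib-+ (λ i → b i * v (suc i) j) (λ i → (b i * t i) * v zero j) ⟩
    ∑ (λ i → b i * v (suc i) j) + ∑ (λ i → (b i * t i) * v zero j)
      ≈⟨ +-congˡ (*-distribʳ-∑ (v zero j) (λ i → b i * t i)) ⟨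
    ∑ (λ i → b i * v (suc i) j) + ∑ (λ i → b i * t i) * v zero j
      ≈⟨ +-comm _ _ ⟩
    ∑ (λ i → b i * t i) * v zero j + ∑ (λ i → b i * v (suc i) j)
      ∎

  IsZero-punchIn : ∀ {n} (x : Vect (suc n)) k → x k ≈ 0# → IsZero (x ∘ punchIn k) → IsZero x
  IsZero-punchIn x k xₖ≈0 rest j with k ≟ᶠ j
  ... | yes ≡.refl = xₖ≈0
  ... | no  k≢j    = ≡.subst (λ i → x i ≈ 0#) (punchIn-punchOut k≢j) (rest (punchOut k≢j))

  -- Gaussian elimination: clear coordinate k of the other vectors with the pivot v zero and
  -- drop that coordinate; a relation among the m reduced vectors of Fⁿ lifts to one among v.
  Dependent-pivot : ∀ {m n} (v : Fin (suc m) → Vect (suc n)) k {p⁻¹} → v zero k * p⁻¹ ≈ 1# →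
                    (∀ (w : Fin m → Vect n) → Dependent w) → Dependent v
  Dependent-pivot {m} {n} v k {p⁻¹} pp⁻¹≈1 dependent = lift (dependent (λ i → reduced i ∘ punchIn k))
    where
    t : Fin m → Carrier
    t i = - (v (suc i) k * p⁻¹)
    reduced : Fin m → Vect (suc n)
    reduced i = v (suc i) +ᵥ t i *ᵥ v zero
    reducedₖ≈0 : ∀ i → reduced i k ≈ 0#
    reducedₖ≈0 i = x+-[x*p⁻¹]*p≈0 (v (suc i) k) pp⁻¹≈1
    lift : Dependent (λ i → reduced i ∘ punchIn k) → Dependent v
    lift (b , b≉0 , rb≈0) = (∑ (λ i → b i * t i) ∷ b) , (λ a≈0 → b≉0 (a≈0 ∘ suc)) , λ j →
      trans (sym (lincomb-rowOp v t b j))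
            (IsZero-punchIn (lincomb reduced b) k (lincomb-vanishing reduced b k reducedₖ≈0) rb≈0 j)

  Dependent-overfull : ∀ n (v : Fin (suc n) → Vect n) → Dependent v
  Dependent-overfull zero    v = Dependent-head-zero v (λ ())
  Dependent-overfull (suc n) v with IsZero? (v zero)
  ... | yes v₀≈0 = Dependent-head-zero v v₀≈0
  ... | no  v₀≉0 with ¬∀⟶∃¬ (suc n) _ (λ j → v zero j ≈? 0#) v₀≉0
  ...   | k , v₀ₖ≉0 = Dependent-pivot v k (proj₂ (inverse (v zero k) v₀ₖ≉0)) (Dependent-overfull n)

  Dependent-⊆span : ∀ {m n} (u : Fin m → Vect n) (v : Fin (suc m) → Vect n) → (∀ i → InSpan u (v i)) →
                    Dependent v
  Dependent-⊆span {m} u v v⊆u = transfer (Dependent-overfull m C)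
    where
    C : Fin (suc m) → Vect m
    C = proj₁ ∘ v⊆u
    transfer : Dependent C → Dependent v
    transfer (a , a≉0 , Ca≈0) =
      a , a≉0 , λ j → trans (lincomb-∘ u v C (proj₂ ∘ v⊆u) a j) (lincomb-zero u Ca≈0 j)

  LinIndep-⊆-spans : ∀ {m n} {ρ σ : Fin m → Vect n} → LinIndep ρ → (∀ i → InSpan σ (ρ i)) →
                     ∀ {x} → InSpan σ x → InSpan ρ x
  LinIndep-⊆-spans {ρ = ρ} {σ} ρ-indep ρ⊆σ {x} x∈σ = express (Dependent-⊆span σ (x ∷ ρ) members)
    where
    members : ∀ i → InSpan σ ((x ∷ ρ) i)
    members zero    = x∈σ
    members (suc i) = ρ⊆σ i
    express : Dependent (x ∷ ρ) → InSpan ρ x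
    express (a , a≉0 , rel) with a zero ≈? 0#
    ... | yes a₀≈0 = contradiction (λ { zero → a₀≈0 ; (suc i) → ρ-indep (a ∘ suc) tail≈0 i }) a≉0
      where
      tail≈0 : IsZero (lincomb ρ (a ∘ suc))
      tail≈0 j = trans (sym (+-identityˡ _)) (trans (+-congʳ (sym (trans (*-congʳ a₀≈0) (zeroˡ (x j))))) (rel j))
    ... | no  a₀≉0 with inverse (a zero) a₀≉0
    ...   | b , a₀b≈1 = (λ i → (- b) * a (suc i)) ,
                        λ j → trans (a*x+y≈0⇒x≈-b*y (rel j) a₀b≈1) (sym (lincomb-* ρ (- b) (a ∘ suc) j))

  SameSpan-⊆ : ∀ {m n} {π π′ : Fin m → Vect n} → LinIndep π → (∀ i → InSpan π′ (π i)) → SameSpan π π′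
  SameSpan-⊆ π-indep π⊆π′ x = InSpan-trans π⊆π′ , LinIndep-⊆-spans π-indep π⊆π′

  InSpan-removeAt : ∀ {m n} (w : Fin (suc m) → Vect n) a i → IsZero (lincomb w a) → ¬ a i ≈ 0# →
                    ∀ {x} → InSpan w x → InSpan (removeAt w i) x
  InSpan-removeAt w a i wa≈0 aᵢ≉0 {x} (β , x≈wβ) = removeAt d i , λ j → begin
    x j                                                    ≈⟨ x≈wβ j ⟩
    lincomb w β j                                          ≈⟨ +-identityʳ _ ⟨
    lincomb w β j + 0#                                     ≈⟨ +-congˡ (trans (*-congˡ (wa≈0 j)) (zeroʳ κ)) ⟨
    lincomb w β j + κ * lincomb w a j                      ≈⟨ +-congˡ (lincomb-* w κ a j) ⟨
    lincomb w β j + lincomb w (λ r → κ * a r) j            ≈⟨ lincomb-+ w β (λ r → κ * a r) j ⟨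
    lincomb w d j                                          ≈⟨ lincomb-removeAt w d i j ⟩
    d i * w i j + lincomb (removeAt w i) (removeAt d i) j  ≈⟨ +-congʳ (trans (*-congʳ dᵢ≈0) (zeroˡ (w i j))) ⟩
    0# + lincomb (removeAt w i) (removeAt d i) j           ≈⟨ +-identityˡ _ ⟩
    lincomb (removeAt w i) (removeAt d i) j                ∎
    where
    aᵢ⁻¹ = inverse (a i) aᵢ≉0
    κ = - (β i * proj₁ aᵢ⁻¹)
    d : _ → Carrier
    d r = β r + κ * a r
    dᵢ≈0 : d i ≈ 0#
    dᵢ≈0 = x+-[x*p⁻¹]*p≈0 (β i) (proj₂ aᵢ⁻¹)

  -- A relation with aᵢ ≉ 0 would leave n − 1 vectors spanning Fⁿ, hence spanning the n
  -- independent basis vectors δ.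
  Spans⇒LinIndep : ∀ {n} (w : Fin n → Vect n) → Spans w → LinIndep w
  Spans⇒LinIndep {suc n} w spans a wa≈0 i with a i ≈? 0#
  ... | yes aᵢ≈0 = aᵢ≈0
  ... | no  aᵢ≉0 with Dependent-⊆span (removeAt w i) δ (λ r → InSpan-removeAt w a i wa≈0 aᵢ≉0 (spans (δ r)))
  ...   | b , b≉0 , δb≈0 = contradiction (LinIndep-δ b δb≈0) b≉0

module IndependentSubspaces {c ℓ} (F : Field c ℓ) (_≈?_ : Decidable (Field._≈_ F)) where
  open Field F hiding (zero)
  open Geometry F
  open LinearAlgebra F _≈?_
  open import Algebra.Properties.Ring ring using (-1*x≈-x; x∙y⁻¹≈ε⇒x≈y)
  open import Algebra.Solver.Ring.NaturalCoefficients.Default commutativeSemiring using (solve; _:+_; _:*_; _:=_)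
  open import Relation.Binary.Reasoning.Setoid setoid

  -- Records rather than Π-types, so that X, Y, Z can be recovered from the type by unification.
  record Independent₂ {k l n} (X : Fin k → Vect n) (Y : Fin l → Vect n) : Set (c ⊔ ℓ) where
    field
      sum₂≈0⇒≈0 : ∀ {u v} → InSpan X u → InSpan Y v → IsZero (u +ᵥ v) → IsZero u × IsZero v

  record Independent₃ {k l m n} (X : Fin k → Vect n) (Y : Fin l → Vect n) (Z : Fin m → Vect n) :
                      Set (c ⊔ ℓ) where
    field
      sum₃≈0⇒≈0 : ∀ {u v w} → InSpan X u → InSpan Y v → InSpan Z w →
                  IsZero (u +ᵥ (v +ᵥ w)) → IsZero u × IsZero v × IsZero w

  open Independent₂ public
  open Independent₃ public

  TransversalThrough : ∀ {k l n} → Vect n → (Fin k → Vect n) → (Fin l → Vect n) → Set (c ⊔ ℓ)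
  TransversalThrough P X Y = Σ (Fin 2 → Vect _) λ L → LinIndep L × InSpan L P × Meets L X × Meets L Y

  LinIndep-++⇒Independent₃ : ∀ {k l m n} {X : Fin k → Vect n} {Y : Fin l → Vect n} {Z : Fin m → Vect n} →
                             LinIndep (X ++ (Y ++ Z)) → Independent₃ X Y Z
  LinIndep-++⇒Independent₃ {X = X} {Y} {Z} indep .sum₃≈0⇒≈0 {u} {v} {w}
                           (s , u≈Xs) (t , v≈Yt) (r , w≈Zr) u+v+w≈0 =
    (λ j → trans (u≈Xs j) (lincomb-zero X s≈0 j)) ,
    (λ j → trans (v≈Yt j) (lincomb-zero Y t≈0 j)) ,
    (λ j → trans (w≈Zr j) (lincomb-zero Z r≈0 j))
    where
    relation : IsZero (lincomb (X ++ (Y ++ Z)) (s ++ (t ++ r)))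
    relation j = begin
      lincomb (X ++ (Y ++ Z)) (s ++ (t ++ r)) j        ≈⟨ lincomb-++-++ X (Y ++ Z) s (t ++ r) j ⟩
      lincomb X s j + lincomb (Y ++ Z) (t ++ r) j      ≈⟨ +-congˡ (lincomb-++-++ Y Z t r j) ⟩
      lincomb X s j + (lincomb Y t j + lincomb Z r j)  ≈⟨ +-cong (u≈Xs j) (+-cong (v≈Yt j) (w≈Zr j)) ⟨
      u j + (v j + w j)                                ≈⟨ u+v+w≈0 j ⟩
      0#                                               ∎
    s≈0 = proj₁ (IsZero-++ s (t ++ r) (indep (s ++ (t ++ r)) relation))
    t++r≈0 = proj₂ (IsZero-++ s (t ++ r) (indep (s ++ (t ++ r)) relation))
    t≈0 = proj₁ (IsZero-++ t r t++r≈0)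
    r≈0 = proj₂ (IsZero-++ t r t++r≈0)

  x+-1*x≈0 : ∀ x → x + - 1# * x ≈ 0#
  x+-1*x≈0 x = trans (+-congˡ (-1*x≈-x x)) (-‿inverseʳ x)

  module _ {k l m n} {X : Fin k → Vect n} {Y : Fin l → Vect n} {Z : Fin m → Vect n} (indep : Independent₃ X Y Z) where

    Independent₃⇒Independent₂-XY : Independent₂ X Y
    Independent₃⇒Independent₂-XY .sum₂≈0⇒≈0 u∈X v∈Y u+v≈0
      with sum₃≈0⇒≈0 indep u∈X v∈Y InSpan-0 (λ j → trans (+-congˡ (+-identityʳ _)) (u+v≈0 j))
    ... | u≈0 , v≈0 , _ = u≈0 , v≈0

    Independent₃⇒Independent₂-XZ : Independent₂ X Z
    Independent₃⇒Independent₂-XZ .sum₂≈0⇒≈0 u∈X w∈Z u+w≈0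
      with sum₃≈0⇒≈0 indep u∈X InSpan-0 w∈Z (λ j → trans (+-congˡ (+-identityˡ _)) (u+w≈0 j))
    ... | u≈0 , _ , w≈0 = u≈0 , w≈0

    Independent₃⇒Independent₂-YZ : Independent₂ Y Z
    Independent₃⇒Independent₂-YZ .sum₂≈0⇒≈0 v∈Y w∈Z v+w≈0
      with sum₃≈0⇒≈0 indep InSpan-0 v∈Y w∈Z (λ j → trans (+-identityˡ _) (v+w≈0 j))
    ... | _ , v≈0 , w≈0 = v≈0 , w≈0

    Independent₃-unique : ∀ {u u′ v v′ w w′} →
                          InSpan X u → InSpan X u′ → InSpan Y v → InSpan Y v′ → InSpan Z w → InSpan Z w′ →
                          (u +ᵥ (v +ᵥ w)) ≈ᵥ (u′ +ᵥ (v′ +ᵥ w′)) →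
                          u ≈ᵥ u′ × v ≈ᵥ v′ × w ≈ᵥ w′
    Independent₃-unique {u} {u′} {v} {v′} {w} {w′} u∈X u′∈X v∈Y v′∈Y w∈Z w′∈Z sum≈sum′ =
      cancels (sum₃≈0⇒≈0 indep (difference u∈X u′∈X) (difference v∈Y v′∈Y) (difference w∈Z w′∈Z)
                                differences≈0)
      where
      difference : ∀ {k} {V : Fin k → Vect n} {x y} → InSpan V x → InSpan V y → InSpan V (x +ᵥ (- 1#) *ᵥ y)
      difference x∈V y∈V = InSpan-+ x∈V (InSpan-* (- 1#) y∈V)
      differences≈0 : IsZero ((u +ᵥ (- 1#) *ᵥ u′) +ᵥ ((v +ᵥ (- 1#) *ᵥ v′) +ᵥ (w +ᵥ (- 1#) *ᵥ w′)))
      differences≈0 j = begin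
        (u j + - 1# * u′ j) + ((v j + - 1# * v′ j) + (w j + - 1# * w′ j))
          ≈⟨ solve 7 (λ a a′ b b′ c c′ μ → (a :+ μ :* a′) :+ ((b :+ μ :* b′) :+ (c :+ μ :* c′))
                                         := (a :+ (b :+ c)) :+ μ :* (a′ :+ (b′ :+ c′))) refl
                   (u j) (u′ j) (v j) (v′ j) (w j) (w′ j) (- 1#) ⟩
        (u j + (v j + w j)) + - 1# * (u′ j + (v′ j + w′ j))     ≈⟨ +-congʳ (sum≈sum′ j) ⟩
        (u′ j + (v′ j + w′ j)) + - 1# * (u′ j + (v′ j + w′ j))  ≈⟨ x+-1*x≈0 _ ⟩
        0#                                                      ∎
      cancel : ∀ {x y : Vect n} → IsZero (x +ᵥ (- 1#) *ᵥ y) → x ≈ᵥ y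
      cancel {x} {y} x-y≈0 j = x∙y⁻¹≈ε⇒x≈y (x j) (y j) (trans (+-congˡ (sym (-1*x≈-x (y j)))) (x-y≈0 j))
      cancels : IsZero (u +ᵥ (- 1#) *ᵥ u′) × IsZero (v +ᵥ (- 1#) *ᵥ v′) × IsZero (w +ᵥ (- 1#) *ᵥ w′) →
                u ≈ᵥ u′ × v ≈ᵥ v′ × w ≈ᵥ w′
      cancels (u-u′≈0 , v-v′≈0 , w-w′≈0) = cancel u-u′≈0 , cancel v-v′≈0 , cancel w-w′≈0

    LinIndep-∷₃ : ∀ {u v w} → InSpan X u → InSpan Y v → InSpan Z w → NonZero u → NonZero v → NonZero w →
                  LinIndep (u ∷ v ∷ w ∷ [])
    LinIndep-∷₃ u∈X v∈Y w∈Z u≉0 v≉0 w≉0 a rel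
      with sum₃≈0⇒≈0 indep (InSpan-* (a 0F) u∈X) (InSpan-* (a 1F) v∈Y) (InSpan-* (a 2F) w∈Z)
                           (λ j → trans (+-congˡ (+-congˡ (sym (+-identityʳ _)))) (rel j))
    ... | a₀u≈0 , a₁v≈0 , a₂w≈0 = λ where
      0F → *ᵥ-IsZero⇒≈0 u≉0 a₀u≈0
      1F → *ᵥ-IsZero⇒≈0 v≉0 a₁v≈0
      2F → *ᵥ-IsZero⇒≈0 w≉0 a₂w≈0

    plane-through : ∀ {P u v w} → InSpan X u → InSpan Y v → InSpan Z w → NonZero u → NonZero v → NonZero w →
                    P ≈ᵥ (u +ᵥ (v +ᵥ w)) →
                    let π = u ∷ v ∷ w ∷ [] in LinIndep π × InSpan π P × Meets π X × Meets π Y × Meets π Z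
    plane-through {P} {u} {v} {w} u∈X v∈Y w∈Z u≉0 v≉0 w≉0 P≈u+v+w =
      LinIndep-∷₃ u∈X v∈Y w∈Z u≉0 v≉0 w≉0 ,
      ((λ _ → 1#) , λ j → trans (P≈u+v+w j)
        (sym (+-cong (*-identityˡ (u j)) (+-cong (*-identityˡ (v j)) (trans (+-identityʳ _) (*-identityˡ (w j))))))) ,
      (u , u≉0 , InSpan-member π 0F , u∈X) ,
      (v , v≉0 , InSpan-member π 1F , v∈Y) ,
      (w , w≉0 , InSpan-member π 2F , w∈Z)
      where
      π : Fin 3 → Vect n
      π = u ∷ v ∷ w ∷ []

    plane-unique : ∀ {P u v w} → InSpan X u → InSpan Y v → InSpan Z w → NonZero u → NonZero v → NonZero w →
                   P ≈ᵥ (u +ᵥ (v +ᵥ w)) →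
                   ∀ (π′ : Fin 3 → Vect n) → InSpan π′ P → Meets π′ X → Meets π′ Y → Meets π′ Z →
                   SameSpan (u ∷ v ∷ w ∷ []) π′
    plane-unique {P} {u} {v} {w} u∈X v∈Y w∈Z u≉0 v≉0 w≉0 P≈u+v+w π′ P∈π′
                 (x , x≉0 , x∈π′ , x∈X) (y , y≉0 , y∈π′ , y∈Y) (z , z≉0 , z∈π′ , z∈Z) =
      SameSpan-⊆ {π′ = π′} (LinIndep-∷₃ u∈X v∈Y w∈Z u≉0 v≉0 w≉0) π⊆π′
      where
      ρ : Fin 3 → Vect n
      ρ = x ∷ y ∷ z ∷ []
      ρ⊆π′ : ∀ i → InSpan π′ (ρ i)
      ρ⊆π′ 0F = x∈π′
      ρ⊆π′ 1F = y∈π′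
      ρ⊆π′ 2F = z∈π′
      P∈ρ : InSpan ρ P
      P∈ρ = LinIndep-⊆-spans {σ = π′} (LinIndep-∷₃ x∈X y∈Y z∈Z x≉0 y≉0 z≉0) ρ⊆π′ P∈π′
      μ : Fin 3 → Carrier
      μ = proj₁ P∈ρ
      components : u ≈ᵥ (μ 0F *ᵥ x) × v ≈ᵥ (μ 1F *ᵥ y) × w ≈ᵥ (μ 2F *ᵥ z)
      components =
        Independent₃-unique u∈X (InSpan-* (μ 0F) x∈X) v∈Y (InSpan-* (μ 1F) y∈Y) w∈Z (InSpan-* (μ 2F) z∈Z)
          (λ j → trans (sym (P≈u+v+w j)) (trans (proj₂ P∈ρ j) (+-congˡ (+-congˡ (+-identityʳ _)))))
      scaled∈π′ : ∀ {p q} i → p ≈ᵥ (μ i *ᵥ q) → InSpan π′ q → InSpan π′ p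
      scaled∈π′ i p≈μq q∈π′ =
        InSpan-resp {v = π′} (λ j → sym (p≈μq j)) (InSpan-* {v = π′} (μ i) q∈π′)
      π⊆π′ : ∀ i → InSpan π′ ((u ∷ v ∷ w ∷ []) i)
      π⊆π′ 0F = scaled∈π′ 0F (proj₁ components) x∈π′
      π⊆π′ 1F = scaled∈π′ 1F (proj₁ (proj₂ components)) y∈π′
      π⊆π′ 2F = scaled∈π′ 2F (proj₂ (proj₂ components)) z∈π′

  nonzero-representative : ∀ {k n} {X : Fin (suc k) → Vect n} → LinIndep X → ∀ {u} → InSpan X u →
                           ∃₂ λ u′ a → NonZero u′ × InSpan X u′ × u ≈ᵥ (a *ᵥ u′)
  nonzero-representative {X = X} X-indep {u} u∈X with IsZero? u
  ... | no  u≉0 = u , 1# , u≉0 , u∈X , λ j → sym (*-identityˡ (u j))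
  ... | yes u≈0 = X 0F , 0# , LinIndep⇒NonZero {v = X} X-indep 0F , InSpan-member X 0F ,
                  λ j → trans (u≈0 j) (sym (zeroˡ (X 0F j)))

  transversal : ∀ {k l n} {X : Fin (suc k) → Vect n} {Y : Fin (suc l) → Vect n} →
                LinIndep X → LinIndep Y → Independent₂ X Y →
                ∀ {P u v} → InSpan X u → InSpan Y v → P ≈ᵥ (u +ᵥ v) → TransversalThrough P X Y
  transversal {X = X} {Y} X-indep Y-indep indep u∈X v∈Y P≈u+v
    with nonzero-representative {X = X} X-indep u∈X | nonzero-representative {X = Y} Y-indep v∈Y
  ... | u′ , a , u′≉0 , u′∈X , u≈au′ | v′ , b , v′≉0 , v′∈Y , v≈bv′ =
    L , L-indep , P∈L ,
    (u′ , u′≉0 , InSpan-member L 0F , u′∈X) ,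
    (v′ , v′≉0 , InSpan-member L 1F , v′∈Y)
    where
    L : Fin 2 → Vect _
    L = u′ ∷ v′ ∷ []
    L-indep : LinIndep L
    L-indep c rel with sum₂≈0⇒≈0 indep (InSpan-* {v = X} (c 0F) u′∈X) (InSpan-* {v = Y} (c 1F) v′∈Y)
                                       (λ j → trans (+-congˡ (sym (+-identityʳ _))) (rel j))
    ... | c₀u′≈0 , c₁v′≈0 = λ where
      0F → *ᵥ-IsZero⇒≈0 u′≉0 c₀u′≈0
      1F → *ᵥ-IsZero⇒≈0 v′≉0 c₁v′≈0
    P∈L : InSpan L _
    P∈L = (a ∷ b ∷ []) , λ j → trans (P≈u+v j) (+-cong (u≈au′ j) (trans (v≈bv′ j) (sym (+-identityʳ _))))

  unique-plane : ∀ {k l m n} {X : Fin (suc k) → Vect n} {Y : Fin (suc l) → Vect n} {Z : Fin (suc m) → Vect n} →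
                 LinIndep X → LinIndep Y → LinIndep Z → Independent₃ X Y Z →
                 ∀ {P u v w} → InSpan X u → InSpan Y v → InSpan Z w → P ≈ᵥ (u +ᵥ (v +ᵥ w)) →
                 ¬ TransversalThrough P X Y → ¬ TransversalThrough P X Z → ¬ TransversalThrough P Y Z →
                 Σ (Fin 3 → Vect n) λ π → (LinIndep π × InSpan π P × Meets π X × Meets π Y × Meets π Z) ×
                   (∀ (π′ : Fin 3 → Vect n) → InSpan π′ P →
                      Meets π′ X → Meets π′ Y → Meets π′ Z → SameSpan π π′)
  unique-plane X-indep Y-indep Z-indep indep {P} {u} {v} {w} u∈X v∈Y w∈Z P≈u+v+w no-XY no-XZ no-YZ =
    u ∷ v ∷ w ∷ [] ,
    plane-through indep u∈X v∈Y w∈Z u≉0 v≉0 w≉0 P≈u+v+w ,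
    plane-unique indep u∈X v∈Y w∈Z u≉0 v≉0 w≉0 P≈u+v+w
    where
    u≉0 : NonZero u
    u≉0 u≈0 = no-YZ (transversal Y-indep Z-indep (Independent₃⇒Independent₂-YZ indep) v∈Y w∈Z
                       (λ j → trans (P≈u+v+w j) (trans (+-congʳ (u≈0 j)) (+-identityˡ _))))
    v≉0 : NonZero v
    v≉0 v≈0 = no-XZ (transversal X-indep Z-indep (Independent₃⇒Independent₂-XZ indep) u∈X w∈Z
                       (λ j → trans (P≈u+v+w j) (+-congˡ (trans (+-congʳ (v≈0 j)) (+-identityˡ _)))))
    w≉0 : NonZero w
    w≉0 w≈0 = no-XY (transversal X-indep Y-indep (Independent₃⇒Independent₂-XY indep) u∈X v∈Y
                       (λ j → trans (P≈u+v+w j) (+-congˡ (trans (+-congˡ (w≈0 j)) (+-identityʳ _)))))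

lemma3p1 : ∀ {c ℓ} (q : ℕ) (K : FiniteField c ℓ q) →
    let open Geometry (FiniteField.fld K) in
    (α β γ : Plane) → LinIndep α → LinIndep β → LinIndep γ →
    Spans (join3 α β γ) →
    (P : Vect 9) → NonZero P →
    ¬ (Σ Line λ l → LinIndep l × InSpan l P ×
         ((Meets l α × Meets l β) ⊎ (Meets l α × Meets l γ) ⊎ (Meets l β × Meets l γ))) →
    Σ Plane λ π → (LinIndep π × InSpan π P × Meets π α × Meets π β × Meets π γ) ×
      (∀ (π′ : Plane) → LinIndep π′ → InSpan π′ P →
         Meets π′ α → Meets π′ β → Meets π′ γ → SameSpan π π′)
-- The linear combinations of join3 α β γ and
-- of α ++ (β ++ γ) agree definitionally, which lets spans serve for both.
lemma3p1 q K α β γ α-indep β-indep γ-indep spans P _ no-transversal =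
  let open LinearAlgebra (FiniteField.fld K) (≈-decidable K)
      open IndependentSubspaces (FiniteField.fld K) (≈-decidable K)
      (u , v , w , u∈α , v∈β , w∈γ , P≈u+v+w) = InSpan-++₃ {X = α} {Y = β} {Z = γ} (spans P)
      independent = LinIndep-++⇒Independent₃ {X = α} {Y = β} {Z = γ} (Spans⇒LinIndep (α ++ (β ++ γ)) spans)
      (π , π-through-P , π-unique) = unique-plane α-indep β-indep γ-indep independent u∈α v∈β w∈γ P≈u+v+w
        (λ (L , L-indep , P∈L , L∩α , L∩β) → no-transversal (L , L-indep , P∈L , inj₁ (L∩α , L∩β)))
        (λ (L , L-indep , P∈L , L∩α , L∩γ) → no-transversal (L , L-indep , P∈L , inj₂ (inj₁ (L∩α , L∩γ))))
        (λ (L , L-indep , P∈L , L∩β , L∩γ) → no-transversal (L , L-indep , P∈L , inj₂ (inj₂ (L∩β , L∩γ))))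
  in π , π-through-P , λ π′ _ → π-unique π′
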